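{- For $n \in \mathbb{Z}^+$ let $\mathcal{X}_n^*$ be the set of all $(f_1,\dots,f_8) \in \mathcal{P}_n^8$ such that the six products $f_1f_2f_3f_4$, $f_5f_6f_7f_8$, $f_1f_2f_5f_6$, $f_3f_4f_7f_8$, $f_1f_3f_5f_7$, $f_2f_4f_6f_8$ all lie in $\mathcal{P}_n$, and \[ \gcd(f_3f_4, f_5f_6) = \gcd(f_2f_4, f_5f_7) = \gcd(f_2,f_3) = \gcd(f_6,f_7) = 1. \] Then $|\mathcal{X}_n^*| = O(n^4\cdot q^{2n})$, with an absolute implied constant.
   Context: $\mathbb{F}$ is a finite field with $q$ elements. $\mathcal{P}_n$ is the set of monic polynomials in $\mathbb{F}[x]$ of degree at most $n$. -}

module Defs where

open import Level using (0ℓ)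
open import Data.Nat as ℕ using (ℕ; zero; suc; _≤_)
open import Data.Fin using (Fin)
open import Data.List using (List; []; _∷_; map; _++_; [_])
open import Data.Vec using (Vec; toList)
import Data.Vec as Vec
open import Data.Vec.Relation.Binary.Pointwise.Inductive using (Pointwise)
open import Data.Product using (Σ; _×_; ∃)
open import Relation.Nullary using (¬_)
open import Relation.Binary.PropositionalEquality using (_≡_)
open import Algebra.Bundles using (CommutativeRing)

record FiniteField : Set₁ where
  field
    commRing : CommutativeRing 0ℓ 0ℓ
  open CommutativeRing commRing public hiding (ring)
  field
    0≉1     : ¬ (0# ≈ 1#)
    inverse : ∀ x → ¬ (x ≈ 0#) → Σ Carrier (λ y → (x * y) ≈ 1#)
    q       : ℕ
    enum    : Fin q → Carrier
    enum-inj : ∀ i j → enum i ≈ enum j → i ≡ j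
    enum-sur : ∀ x → ∃ λ i → enum i ≈ x

module Poly (F : FiniteField) where
  open FiniteField F

  -- polynomials as coefficient lists, lowest degree first
  addP : List Carrier → List Carrier → List Carrier
  addP [] g = g
  addP (a ∷ f) [] = a ∷ f
  addP (a ∷ f) (b ∷ g) = (a + b) ∷ addP f g

  mulP : List Carrier → List Carrier → List Carrier
  mulP [] g = []
  mulP (a ∷ f) g = addP (map (a *_) g) (0# ∷ mulP f g)

  -- a monic polynomial of degree deg: x^deg + low_{deg-1} x^{deg-1} + ... + low_0
  record Monic : Set where
    constructor monic
    field
      deg : ℕ
      low : Vec Carrier deg
  open Monic public

  coeffs : Monic → List Carrier
  coeffs f = toList (low f) ++ [ 1# ]

  firstK : (k : ℕ) → List Carrier → Vec Carrier k
  firstK zero xs = Vec.[]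
  firstK (suc k) [] = 0# Vec.∷ firstK k []
  firstK (suc k) (x ∷ xs) = x Vec.∷ firstK k xs

  _·_ : Monic → Monic → Monic
  f · g = monic (deg f ℕ.+ deg g) (firstK (deg f ℕ.+ deg g) (mulP (coeffs f) (coeffs g)))
  infixl 7 _·_

  _≋_ : Monic → Monic → Set
  f ≋ g = Pointwise _≈_ (low f) (low g)

  InP : ℕ → Monic → Set
  InP n f = deg f ≤ n

  _∣_ : Monic → Monic → Set
  d ∣ f = Σ Monic (λ h → (d · h) ≋ f)

  GcdOne : Monic → Monic → Set
  GcdOne f g = ∀ d → d ∣ f → d ∣ g → deg d ≡ 0

  record Oct : Set where
    constructor oct
    field f1 f2 f3 f4 f5 f6 f7 f8 : Monic
  open Oct public

  _≋₈_ : Oct → Oct → Set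
  a ≋₈ b = (f1 a ≋ f1 b) × (f2 a ≋ f2 b) × (f3 a ≋ f3 b) × (f4 a ≋ f4 b)
         × (f5 a ≋ f5 b) × (f6 a ≋ f6 b) × (f7 a ≋ f7 b) × (f8 a ≋ f8 b)

  InX : ℕ → Oct → Set
  InX n t =
      InP n (f1 t) × InP n (f2 t) × InP n (f3 t) × InP n (f4 t)
    × InP n (f5 t) × InP n (f6 t) × InP n (f7 t) × InP n (f8 t)
    × InP n (f1 t · f2 t · f3 t · f4 t) × InP n (f5 t · f6 t · f7 t · f8 t)
    × InP n (f1 t · f2 t · f5 t · f6 t) × InP n (f3 t · f4 t · f7 t · f8 t)
    × InP n (f1 t · f3 t · f5 t · f7 t) × InP n (f2 t · f4 t · f6 t · f8 t)
    × GcdOne (f3 t · f4 t) (f5 t · f6 t)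
    × GcdOne (f2 t · f4 t) (f5 t · f7 t)
    × GcdOne (f2 t) (f3 t)
    × GcdOne (f6 t) (f7 t)

-- An octuple is determined by its degree
-- pattern (x1, …, x8) together with the S = x1 + … + x8 lower coefficients of
-- its eight monic factors.  The six face products of degree ≤ n force S ≤ 2n,
-- and writing k = 2n - S, the pattern is determined by the four degrees
-- x1, x2, x3, x5 (each ≤ n) and the three face slacks n - deg(f1f2f3f4),
-- n - deg(f1f2f5f6), n - deg(f1f3f5f7) (each ≤ k).  Hence
--   |X_n^*| ≤ (n+1)^4 · Σ_{k ≤ 2n} (k+1)^3 q^(2n-k) ≤ 16 n^4 · 257 q^(2n).
-- We make this precise by an injective code into ℕ: the coefficients and the
-- slacks are packed by mixed-radix arithmetic into a number below
-- q^(2n-k)(k+1)^3, these numbers are laid out in consecutive blocks indexed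
-- by k, and the free degrees form the outermost digits.
module Submission where

open import Defs
open import Data.Nat using (ℕ; zero; suc; _+_; _*_; _^_; _∸_; _≤_; _<_; z≤n; s≤s; _≤?_)
open import Data.Nat.Properties
open import Data.Nat.Tactic.RingSolver using (solve-∀)
open import Data.Fin as Fin using (Fin; toℕ; fromℕ<)
open import Data.Fin.Properties using (pigeonhole; toℕ<n; toℕ-injective; fromℕ<-injective)
open import Data.List using (List; length; lookup)
open import Data.List.Membership.Propositional.Properties using (∈-lookup)
open import Data.List.Relation.Unary.All as All using (All)
open import Data.List.Relation.Unary.AllPairs using (AllPairs; _∷_)
open import Data.Vec using (Vec; []; _∷_; _++_)
open import Data.Vec.Relation.Binary.Pointwise.Inductive using (Pointwise; []; _∷_)
open import Data.Product using (Σ; _×_; _,_; proj₁; proj₂)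
open import Data.Sum using (inj₁; inj₂)
open import Data.Empty using (⊥-elim)
open import Relation.Nullary using (¬_; yes; no)
open import Relation.Binary.PropositionalEquality
open import Relation.Binary.Definitions using (tri<; tri≈; tri>)

all-at : ∀ {A : Set} {P : A → Set} {xs : List A} → All P xs → (i : Fin (length xs)) → P (lookup xs i)
all-at ps i = All.lookup ps (∈-lookup i)

allPairs-at : ∀ {A : Set} {R : A → A → Set} {xs : List A} → AllPairs R xs
  → (i j : Fin (length xs)) → i Fin.< j → R (lookup xs i) (lookup xs j)
allPairs-at (r ∷ rs) Fin.zero    (Fin.suc j) _         = all-at r j
allPairs-at (r ∷ rs) (Fin.suc i) (Fin.suc j) (s≤s i<j) = allPairs-at rs i j i<j

code-bound : ∀ {A : Set} {P : A → Set} {_~_ : A → A → Set} (M : ℕ) (c : A → ℕ)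
  → (∀ a → P a → c a < M) → (∀ a b → P a → P b → c a ≡ c b → a ~ b)
  → {xs : List A} → All P xs → AllPairs (λ a b → ¬ a ~ b) xs → length xs ≤ M
code-bound M c below injective {xs} ps distinct with length xs ≤? M
... | yes fits = fits
... | no too-long
  with i , j , i<j , same ← pigeonhole (≰⇒> too-long) (λ i → fromℕ< (below _ (all-at ps i)))
  = ⊥-elim (allPairs-at distinct i j i<j
      (injective _ _ (all-at ps i) (all-at ps j) (fromℕ<-injective _ _ _ _ same)))

radix-< : ∀ {s t c x} → c < s → x < t → c + s * x < s * t
radix-< {s} {t} {c} {x} c<s x<t = begin-strict
  c + s * x     <⟨ +-monoˡ-< (s * x) c<s ⟩
  s + s * x     ≡⟨ *-suc s x ⟨
  s * suc x     ≤⟨ *-monoʳ-≤ s x<t ⟩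
  s * t         ∎
  where open ≤-Reasoning

radix-injective : ∀ {s s' c c' x y} → s ≡ s' → c < s → c' < s'
  → c + s * x ≡ c' + s' * y → c ≡ c' × x ≡ y
radix-injective {s} {_} {c} {c'} {x} {y} refl c<s c'<s eq with <-cmp x y
... | tri< x<y _ _ = ⊥-elim (<-irrefl eq (<-≤-trans (radix-< c<s x<y) (m≤n+m (s * y) c')))
... | tri> _ _ y<x = ⊥-elim (<-irrefl (sym eq) (<-≤-trans (radix-< c'<s y<x) (m≤n+m (s * x) c)))
... | tri≈ _ refl _ = +-cancelʳ-≡ (s * x) c c' eq , refl

offset : (ℕ → ℕ) → ℕ → ℕ
offset f zero    = 0
offset f (suc k) = offset f k + f k

offset-mono : ∀ f {k k'} → k ≤ k' → offset f k ≤ offset f k'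
offset-mono f {k' = zero}   z≤n = ≤-refl
offset-mono f {k} {suc k'} k≤1+k' with m≤n⇒m<n∨m≡n k≤1+k'
... | inj₂ refl = ≤-refl
... | inj₁ k<1+k' = ≤-trans (offset-mono f (≤-pred k<1+k')) (m≤m+n (offset f k') (f k'))

offset-< : ∀ f {k K c} → k < K → c < f k → offset f k + c < offset f K
offset-< f {k} {K} {c} k<K c<fk = <-≤-trans (+-monoʳ-< (offset f k) c<fk) (offset-mono f k<K)

offset-injective : ∀ f {k k' c c'} → c < f k → c' < f k'
  → offset f k + c ≡ offset f k' + c' → k ≡ k' × c ≡ c'
offset-injective f {k} {k'} {c} {c'} c<fk c'<fk' eq with <-cmp k k'
... | tri< k<k' _ _ = ⊥-elim (<-irrefl eq (<-≤-trans (offset-< f k<k' c<fk) (m≤m+n _ c')))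
... | tri> _ _ k'<k = ⊥-elim (<-irrefl (sym eq) (<-≤-trans (offset-< f k'<k c'<fk') (m≤m+n _ c)))
... | tri≈ _ refl _ = refl , +-cancelˡ-≡ (offset f k) c c' eq

-- (k+1)^3: the number of possible triples of slacks when k coefficients are missing.
cube : ℕ → ℕ
cube k = suc k * (suc k * suc k)

-- Block k of the layout: q^(m-k) coefficient vectors times (k+1)^3 slack triples.
blockSize : ℕ → ℕ → ℕ → ℕ
blockSize q m k = q ^ (m ∸ k) * cube k

blockTotal : ℕ → ℕ → ℕ
blockTotal q m = offset (blockSize q m) (suc m)

offset-scale : ∀ q m k → k ≤ suc m → offset (blockSize q (suc m)) k ≡ q * offset (blockSize q m) k
offset-scale q m zero    _       = sym (*-zeroʳ q)
offset-scale q m (suc k) k<1+m = begin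
    offset (blockSize q (suc m)) k + q ^ (suc m ∸ k) * cube k
  ≡⟨ cong₂ _+_ (offset-scale q m k (≤-trans (n≤1+n k) k<1+m))
               (cong (λ e → q ^ e * cube k) (+-∸-assoc 1 (≤-pred k<1+m))) ⟩
    q * offset (blockSize q m) k + q * q ^ (m ∸ k) * cube k
  ≡⟨ factor q (offset (blockSize q m) k) (q ^ (m ∸ k)) (cube k) ⟩
    q * (offset (blockSize q m) k + q ^ (m ∸ k) * cube k) ∎
  where
  open ≡-Reasoning
  factor : ∀ a b c d → a * b + a * c * d ≡ a * (b + c * d)
  factor = solve-∀

-- A potential paying for the cube added when m grows:
-- potential (m+1) + (m+2)^3 ≤ 2 · potential m.
potential : ℕ → ℕ
potential m = 4 * ((m + 4) * ((m + 4) * (m + 4)))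

cube-absorbed : ∀ m → potential (suc m) + cube (suc m) ≤ 2 * potential m
cube-absorbed m = ≤-trans (m≤m+n _ _) (≤-reflexive (sym (expand m)))
  where
  expand : ∀ m → 2 * (4 * ((m + 4) * ((m + 4) * (m + 4))))
             ≡ (4 * ((suc m + 4) * ((suc m + 4) * (suc m + 4))) + suc (suc m) * (suc (suc m) * suc (suc m)))
               + (3 * (m + 4) * m * (m + 6) + 4)
  expand = solve-∀

-- For q ≥ 2, Σ_{k ≤ m} q^(m-k) (k+1)^3 ≤ 257 q^m; the invariant carries the
-- potential along, and 257 = blockTotal q 0 + potential 0.
blockTotal+potential : ∀ {q} → 2 ≤ q → ∀ m → blockTotal q m + potential m ≤ 257 * q ^ m
blockTotal+potential q≥2 zero = ≤-refl
blockTotal+potential {q} q≥2 (suc m) = begin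
    (offset (blockSize q (suc m)) (suc m) + q ^ (suc m ∸ suc m) * cube (suc m)) + potential (suc m)
  ≡⟨ cong₂ (λ a e → (a + q ^ e * cube (suc m)) + potential (suc m)) (offset-scale q m (suc m) ≤-refl) (n∸n≡0 m) ⟩
    (q * blockTotal q m + 1 * cube (suc m)) + potential (suc m)
  ≡⟨ regroup (q * blockTotal q m) (cube (suc m)) (potential (suc m)) ⟩
    q * blockTotal q m + (potential (suc m) + cube (suc m))
  ≤⟨ +-monoʳ-≤ (q * blockTotal q m) (≤-trans (cube-absorbed m) (*-monoˡ-≤ (potential m) q≥2)) ⟩
    q * blockTotal q m + q * potential m
  ≡⟨ *-distribˡ-+ q (blockTotal q m) (potential m) ⟨
    q * (blockTotal q m + potential m)
  ≤⟨ *-monoʳ-≤ q (blockTotal+potential q≥2 m) ⟩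
    q * (257 * q ^ m)
  ≡⟨ swap q (q ^ m) ⟩
    257 * (q * q ^ m) ∎
  where
  open ≤-Reasoning
  regroup : ∀ a b c → (a + 1 * b) + c ≡ a + (c + b)
  regroup = solve-∀
  swap : ∀ a b → a * (257 * b) ≡ 257 * (a * b)
  swap = solve-∀

blockTotal-bound : ∀ {q} → 2 ≤ q → ∀ m → blockTotal q m ≤ 257 * q ^ m
blockTotal-bound q≥2 m = ≤-trans (m≤m+n _ (potential m)) (blockTotal+potential q≥2 m)

record Pattern : Set where
  constructor degrees
  field x1 x2 x3 x4 x5 x6 x7 x8 : ℕ
open Pattern

-- Total number of lower coefficients (nested like a concatenation of vectors).
total : Pattern → ℕ
total p = x1 p + (x2 p + (x3 p + (x4 p + (x5 p + (x6 p + (x7 p + x8 p))))))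

face1234 face5678 face1256 face3478 face1357 face2468 : Pattern → ℕ
face1234 p = x1 p + x2 p + x3 p + x4 p
face5678 p = x5 p + x6 p + x7 p + x8 p
face1256 p = x1 p + x2 p + x5 p + x6 p
face3478 p = x3 p + x4 p + x7 p + x8 p
face1357 p = x1 p + x3 p + x5 p + x7 p
face2468 p = x2 p + x4 p + x6 p + x8 p

total-1234+5678 : ∀ p → total p ≡ face1234 p + face5678 p
total-1234+5678 (degrees a b c d e f g h) = shuffle a b c d e f g h
  where
  shuffle : ∀ a b c d e f g h → a + (b + (c + (d + (e + (f + (g + h))))))
                             ≡ (a + b + c + d) + (e + f + g + h)
  shuffle = solve-∀

total-1256+3478 : ∀ p → total p ≡ face1256 p + face3478 p
total-1256+3478 (degrees a b c d e f g h) = shuffle a b c d e f g h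
  where
  shuffle : ∀ a b c d e f g h → a + (b + (c + (d + (e + (f + (g + h))))))
                             ≡ (a + b + e + f) + (c + d + g + h)
  shuffle = solve-∀

total-1357+2468 : ∀ p → total p ≡ face1357 p + face2468 p
total-1357+2468 (degrees a b c d e f g h) = shuffle a b c d e f g h
  where
  shuffle : ∀ a b c d e f g h → a + (b + (c + (d + (e + (f + (g + h))))))
                             ≡ (a + c + e + g) + (b + d + f + h)
  shuffle = solve-∀

-- The degree conditions defining X_n^*.
record Admissible (n : ℕ) (p : Pattern) : Set where
  field
    x1≤ : x1 p ≤ n
    x2≤ : x2 p ≤ n
    x3≤ : x3 p ≤ n
    x5≤ : x5 p ≤ n
    face1234≤ : face1234 p ≤ n
    face5678≤ : face5678 p ≤ n
    face1256≤ : face1256 p ≤ n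
    face3478≤ : face3478 p ≤ n
    face1357≤ : face1357 p ≤ n
    face2468≤ : face2468 p ≤ n
open Admissible

slack≤ : ∀ {n a b s} → s ≡ a + b → a ≤ n → b ≤ n → n ∸ a ≤ 2 * n ∸ s
slack≤ {n} {a} {b} refl a≤n b≤n = m+n≤o⇒m≤o∸n (n ∸ a) (begin
  n ∸ a + (a + b)  ≡⟨ +-assoc (n ∸ a) a b ⟨
  n ∸ a + a + b    ≡⟨ cong (_+ b) (m∸n+n≡m a≤n) ⟩
  n + b            ≤⟨ +-monoʳ-≤ n b≤n ⟩
  n + n            ≡⟨ cong (n +_) (+-identityʳ n) ⟨
  2 * n            ∎)
  where open ≤-Reasoning

last-summand : ∀ {a b c d a' b' c' d'} → a ≡ a' → b ≡ b' → c ≡ c'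
  → a + b + c + d ≡ a' + b' + c' + d' → d ≡ d'
last-summand {a} {b} {c} refl refl refl = +-cancelˡ-≡ (a + b + c) _ _

module Patterns (n : ℕ) where

  -- The number of "missing" coefficients k = 2n - S; it indexes the block.
  gap : Pattern → ℕ
  gap p = 2 * n ∸ total p

  freeCode : Pattern → ℕ
  freeCode p = x5 p + suc n * (x3 p + suc n * (x2 p + suc n * x1 p))

  slackCode : Pattern → ℕ
  slackCode p = (n ∸ face1234 p) + suc (gap p) * ((n ∸ face1256 p) + suc (gap p) * (n ∸ face1357 p))

  module _ {p : Pattern} (adm : Admissible n p) where

    total≤ : total p ≤ 2 * n
    total≤ = begin
      total p                    ≡⟨ total-1234+5678 p ⟩
      face1234 p + face5678 p    ≤⟨ +-mono-≤ (face1234≤ adm) (face5678≤ adm) ⟩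
      n + n                      ≡⟨ cong (n +_) (+-identityʳ n) ⟨
      2 * n                      ∎
      where open ≤-Reasoning

    freeCode-< : freeCode p < suc n * (suc n * (suc n * suc n))
    freeCode-< = radix-< (s≤s (x5≤ adm)) (radix-< (s≤s (x3≤ adm)) (radix-< (s≤s (x2≤ adm)) (s≤s (x1≤ adm))))

    slack1234-< : n ∸ face1234 p < suc (gap p)
    slack1234-< = s≤s (slack≤ (total-1234+5678 p) (face1234≤ adm) (face5678≤ adm))

    slack1256-< : n ∸ face1256 p < suc (gap p)
    slack1256-< = s≤s (slack≤ (total-1256+3478 p) (face1256≤ adm) (face3478≤ adm))

    slack1357-< : n ∸ face1357 p < suc (gap p)
    slack1357-< = s≤s (slack≤ (total-1357+2468 p) (face1357≤ adm) (face2468≤ adm))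

    slackCode-< : slackCode p < cube (gap p)
    slackCode-< = radix-< slack1234-< (radix-< slack1256-< slack1357-<)

  total-from-gap : ∀ {p p'} → Admissible n p → Admissible n p' → gap p ≡ gap p' → total p ≡ total p'
  total-from-gap adm adm' = ∸-cancelˡ-≡ (total≤ adm) (total≤ adm')

  -- The free degrees, the gap and the slacks determine the whole pattern:
  -- the slacks give three faces, which give x4, x6, x7; the total gives x8.
  pattern-injective : ∀ {p p'} → Admissible n p → Admissible n p'
    → freeCode p ≡ freeCode p' → gap p ≡ gap p' → slackCode p ≡ slackCode p' → p ≡ p'
  pattern-injective {p} {p'} adm adm' free≡ gap≡ slack≡
    with e5 , free≡ ← radix-injective refl (s≤s (x5≤ adm)) (s≤s (x5≤ adm')) free≡
    with e3 , free≡ ← radix-injective refl (s≤s (x3≤ adm)) (s≤s (x3≤ adm')) free≡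
    with e2 , e1 ← radix-injective refl (s≤s (x2≤ adm)) (s≤s (x2≤ adm')) free≡
    with s1234 , slack≡ ← radix-injective (cong suc gap≡) (slack1234-< adm) (slack1234-< adm') slack≡
    with s1256 , s1357 ← radix-injective (cong suc gap≡) (slack1256-< adm) (slack1256-< adm') slack≡
    = degrees-≡ e1 e2 e3 e4 e5 e6 e7 e8
    where
    f1234 : face1234 p ≡ face1234 p'
    f1234 = ∸-cancelˡ-≡ (face1234≤ adm) (face1234≤ adm') s1234
    e4 : x4 p ≡ x4 p'
    e4 = last-summand e1 e2 e3 f1234
    e6 : x6 p ≡ x6 p'
    e6 = last-summand e1 e2 e5 (∸-cancelˡ-≡ (face1256≤ adm) (face1256≤ adm') s1256)
    e7 : x7 p ≡ x7 p'
    e7 = last-summand e1 e3 e5 (∸-cancelˡ-≡ (face1357≤ adm) (face1357≤ adm') s1357)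
    f5678 : face5678 p ≡ face5678 p'
    f5678 = +-cancelˡ-≡ (face1234 p) _ _ (begin
      face1234 p + face5678 p    ≡⟨ total-1234+5678 p ⟨
      total p                    ≡⟨ total-from-gap adm adm' gap≡ ⟩
      total p'                   ≡⟨ total-1234+5678 p' ⟩
      face1234 p' + face5678 p'  ≡⟨ cong (_+ face5678 p') f1234 ⟨
      face1234 p + face5678 p'   ∎)
      where open ≡-Reasoning
    e8 : x8 p ≡ x8 p'
    e8 = last-summand e5 e6 e7 f5678
    degrees-≡ : ∀ {a b c d e f g h a' b' c' d' e' f' g' h'}
      → a ≡ a' → b ≡ b' → c ≡ c' → d ≡ d' → e ≡ e' → f ≡ f' → g ≡ g' → h ≡ h'
      → degrees a b c d e f g h ≡ degrees a' b' c' d' e' f' g' h'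
    degrees-≡ refl refl refl refl refl refl refl refl = refl

distinct-below⇒2≤ : ∀ {a b q} → a < q → b < q → a ≢ b → 2 ≤ q
distinct-below⇒2≤ {zero}  {zero}  _ _ a≢b = ⊥-elim (a≢b refl)
distinct-below⇒2≤ {zero}  {suc b} _ (s≤s b<q) _ = s≤s (<-≤-trans (s≤s z≤n) b<q)
distinct-below⇒2≤ {suc a} {_} (s≤s a<q) _ _ = s≤s (<-≤-trans (s≤s z≤n) a<q)

split-++ : ∀ {A : Set} {_∼_ : A → A → Set} {m m' k k'} (u : Vec A m) (u' : Vec A m')
  {w : Vec A k} {w' : Vec A k'} → m ≡ m'
  → Pointwise _∼_ (u ++ w) (u' ++ w') → Pointwise _∼_ u u' × Pointwise _∼_ w w'
split-++ []      []       refl ps       = [] , ps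
split-++ (x ∷ u) (x' ∷ u') refl (r ∷ ps) with u∼u' , w∼w' ← split-++ u u' refl ps = r ∷ u∼u' , w∼w'

module Digits (F : FiniteField) where
  open FiniteField F using (Carrier; _≈_; q; enum; enum-sur; 0≉1; 0#; 1#)
    renaming (sym to ≈-sym; trans to ≈-trans)

  digit : Carrier → ℕ
  digit x = toℕ (proj₁ (enum-sur x))

  digit-< : ∀ x → digit x < q
  digit-< x = toℕ<n _

  digit-injective : ∀ x y → digit x ≡ digit y → x ≈ y
  digit-injective x y same = ≈-trans (≈-sym (proj₂ (enum-sur x)))
    (subst (λ i → enum i ≈ y) (sym (toℕ-injective same)) (proj₂ (enum-sur y)))

  2≤q : 2 ≤ q
  2≤q = distinct-below⇒2≤ (digit-< 0#) (digit-< 1#) (λ same → 0≉1 (digit-injective 0# 1# same))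

  number : ∀ {k} → Vec Carrier k → ℕ
  number []      = 0
  number (x ∷ v) = digit x + q * number v

  number-< : ∀ {k} (v : Vec Carrier k) → number v < q ^ k
  number-< []      = s≤s z≤n
  number-< (x ∷ v) = radix-< (digit-< x) (number-< v)

  number-injective : ∀ {k k'} (u : Vec Carrier k) (v : Vec Carrier k') → k ≡ k'
    → number u ≡ number v → Pointwise _≈_ u v
  number-injective []      []      _    _    = []
  number-injective (x ∷ u) (y ∷ v) k≡k' same
    with x≡y , u≡v ← radix-injective refl (digit-< x) (digit-< y) same
    = digit-injective x y x≡y ∷ number-injective u v (suc-injective k≡k') u≡v

module Octuples (F : FiniteField) (n : ℕ) where
  open FiniteField F using (Carrier; _≈_; q)
  open Poly F
  open Digits F
  open Patterns n

  patternOf : Oct → Pattern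
  patternOf t = degrees (deg (f1 t)) (deg (f2 t)) (deg (f3 t)) (deg (f4 t))
                        (deg (f5 t)) (deg (f6 t)) (deg (f7 t)) (deg (f8 t))

  -- The degree of a product is the sum of the degrees, so the face conditions
  -- of X_n^* are exactly the face bounds of the pattern.
  admissible : ∀ t → InX n t → Admissible n (patternOf t)
  admissible t (b1 , b2 , b3 , _ , b5 , _ , _ , _ , b1234 , b5678 , b1256 , b3478 , b1357 , b2468 , _) = record
    { x1≤ = b1 ; x2≤ = b2 ; x3≤ = b3 ; x5≤ = b5
    ; face1234≤ = b1234 ; face5678≤ = b5678 ; face1256≤ = b1256
    ; face3478≤ = b3478 ; face1357≤ = b1357 ; face2468≤ = b2468 }

  coefficients : (t : Oct) → Vec Carrier (total (patternOf t))
  coefficients t = low (f1 t) ++ (low (f2 t) ++ (low (f3 t) ++ (low (f4 t)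
                ++ (low (f5 t) ++ (low (f6 t) ++ (low (f7 t) ++ low (f8 t)))))))

  coefficients-determine : ∀ t t' → patternOf t ≡ patternOf t'
    → Pointwise _≈_ (coefficients t) (coefficients t') → t ≋₈ t'
  coefficients-determine t t' same pw
    with p1 , pw ← split-++ (low (f1 t)) (low (f1 t')) (cong x1 same) pw
    with p2 , pw ← split-++ (low (f2 t)) (low (f2 t')) (cong x2 same) pw
    with p3 , pw ← split-++ (low (f3 t)) (low (f3 t')) (cong x3 same) pw
    with p4 , pw ← split-++ (low (f4 t)) (low (f4 t')) (cong x4 same) pw
    with p5 , pw ← split-++ (low (f5 t)) (low (f5 t')) (cong x5 same) pw
    with p6 , pw ← split-++ (low (f6 t)) (low (f6 t')) (cong x6 same) pw
    with p7 , p8 ← split-++ (low (f7 t)) (low (f7 t')) (cong x7 same) pw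
    = p1 , p2 , p3 , p4 , p5 , p6 , p7 , p8

  m : ℕ
  m = 2 * n

  fibreCode : Oct → ℕ
  fibreCode t = number (coefficients t) + q ^ total (patternOf t) * slackCode (patternOf t)

  code : Oct → ℕ
  code t = (offset (blockSize q m) (gap (patternOf t)) + fibreCode t)
         + blockTotal q m * freeCode (patternOf t)

  fibreCode-< : ∀ t → InX n t → fibreCode t < blockSize q m (gap (patternOf t))
  fibreCode-< t h = subst (λ e → fibreCode t < q ^ e * cube (gap (patternOf t)))
    (sym (m∸[m∸n]≡n (total≤ (admissible t h))))
    (radix-< (number-< (coefficients t)) (slackCode-< (admissible t h)))

  blockCode-< : ∀ t → InX n t → offset (blockSize q m) (gap (patternOf t)) + fibreCode t < blockTotal q m
  blockCode-< t h = offset-< (blockSize q m) (s≤s (m∸n≤m m (total (patternOf t)))) (fibreCode-< t h)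

  code-< : ∀ t → InX n t → code t < blockTotal q m * (suc n * (suc n * (suc n * suc n)))
  code-< t h = radix-< (blockCode-< t h) (freeCode-< (admissible t h))

  code-injective : ∀ t t' → InX n t → InX n t' → code t ≡ code t' → t ≋₈ t'
  code-injective t t' h h' same
    with block≡ , free≡ ← radix-injective refl (blockCode-< t h) (blockCode-< t' h') same
    with gap≡ , fibre≡ ← offset-injective (blockSize q m) (fibreCode-< t h) (fibreCode-< t' h') block≡
    with total≡ ← total-from-gap (admissible t h) (admissible t' h') gap≡
    with coefficients≡ , slack≡ ← radix-injective (cong (q ^_) total≡)
           (number-< (coefficients t)) (number-< (coefficients t')) fibre≡
    = coefficients-determine t t'
        (pattern-injective (admissible t h) (admissible t' h') free≡ gap≡ slack≡)
        (number-injective (coefficients t) (coefficients t') total≡ coefficients≡)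

-- (n+1)^4 · 257 Q ≤ 4112 n^4 Q, using n + 1 ≤ 2n for n ≥ 1.
final-estimate : ∀ {n Q T} → 1 ≤ n → T ≤ 257 * Q
  → T * (suc n * (suc n * (suc n * suc n))) ≤ 4112 * n ^ 4 * Q
final-estimate {n} {Q} 1≤n T≤ = ≤-trans
  (*-mono-≤ T≤ (*-mono-≤ 1+n≤2n (*-mono-≤ 1+n≤2n (*-mono-≤ 1+n≤2n 1+n≤2n))))
  (≤-reflexive (expand n Q))
  where
  1+n≤2n : suc n ≤ 2 * n
  1+n≤2n = subst (suc n ≤_) (cong (n +_) (sym (+-identityʳ n))) (+-monoˡ-≤ n 1≤n)
  expand : ∀ n Q → 257 * Q * ((2 * n) * ((2 * n) * ((2 * n) * (2 * n))))
                 ≡ 4112 * (n * (n * (n * (n * 1)))) * Q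
  expand = solve-∀

lemma17 : Σ ℕ λ C → (F : FiniteField) → (n : ℕ) → 1 ≤ n
    → (xs : List (Poly.Oct F))
    → All (Poly.InX F n) xs
    → AllPairs (λ a b → ¬ Poly._≋₈_ F a b) xs
    → length xs ≤ C * n ^ 4 * FiniteField.q F ^ (2 * n)
lemma17 = 4112 , λ F n 1≤n xs inX distinct →
  let open Octuples F n in
  ≤-trans (code-bound _ code code-< code-injective inX distinct)
          (final-estimate 1≤n (blockTotal-bound (Digits.2≤q F) m))
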